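{- Let $\Lambda$ be a restorative similarity type and $\mathfrak{M}=\langle W,R,\{P_k\}_{k\in K}\rangle$ a modally saturated Kripke model. Then for all $w,v\in W$: $w\rightsquigarrow_\Lambda v$ if and only if $w\mathrel{\underline{\to}}_\Lambda v$.
   Context: $w\rightsquigarrow_\Lambda v$ means: for every $\varphi\in\mathcal{L}_\Lambda$, $\mathfrak{M},w\Vdash\varphi$ implies $\mathfrak{M},v\Vdash\varphi$. $w\mathrel{\underline{\to}}_\Lambda v$ means: there is a $\Lambda$-simulation $S$ on $\mathfrak{M}$ with $(w,v)\in S$. Fix a set $K$ of indices for propositional letters $p_k$. A Kripke model is $\mathfrak{M}=\langle W,R,\{P_k\}_{k\in K}\rangle$ with $W$ nonempty, $R\subseteq W\times W$, each $P_k\subseteq W$; $R[w]=\{v: wRv\}$. Consider six unary connectives $\smile,\frown,\circ_\smile,\circ_\frown,\bullet_\smile,\bullet_\frown$; a restorative similarity type is any subset $\Lambda$ of this set. $\mathcal{L}_\Lambda$ is generated by $\phi::=p_k\mid\top\mid\bot\mid\phi\wedge\phi\mid\phi\vee\phi\mid\star\phi$ ($k\in K$, $\star\in\Lambda$). Satisfaction: $w\Vdash p_k$ iff $w\in P_k$; $\top$ true everywhere, $\bot$ nowhere; $\wedge,\vee$ classical; $w\Vdash\smile\phi$ iff some $v$ with $wRv$ has $v\not\Vdash\phi$; $w\Vdash\frown\phi$ iff every $v$ with $wRv$ has $v\not\Vdash\phi$; $w\Vdash\circ_\smile\phi$ iff $w\not\Vdash\phi$ or every $v$ with $wRv$ has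 $v\Vdash\phi$; $w\Vdash\circ_\frown\phi$ iff $w\Vdash\phi$ or every $v$ with $wRv$ has $v\not\Vdash\phi$; $w\Vdash\bullet_\smile\phi$ iff $w\Vdash\phi$ and some $v$ with $wRv$ has $v\not\Vdash\phi$; $w\Vdash\bullet_\frown\phi$ iff $w\not\Vdash\phi$ and some $v$ with $wRv$ has $v\Vdash\phi$. $\mathcal{L}_{\sim,\Box,\Diamond}$ is generated by $\phi::=p_k\mid\top\mid\bot\mid\phi\wedge\phi\mid\phi\vee\phi\mid\sim\phi\mid\Box\phi\mid\Diamond\phi$ with $w\Vdash\sim\phi$ iff $w\not\Vdash\phi$, $w\Vdash\Box\phi$ iff all $v\in R[w]$ satisfy $\phi$, $w\Vdash\Diamond\phi$ iff some $v\in R[w]$ satisfies $\phi$. $\mathfrak{M}$ is modally saturated if for every $w\in W$ and every $\Delta\subseteq\mathcal{L}_{\sim,\Box,\Diamond}$, if every finite subset of $\Delta$ is satisfied at some world of $R[w]$, then some world of $R[w]$ satisfies all of $\Delta$. A relation $S\subseteq W\times W$ is a $\Lambda$-simulation on $\mathfrak{M}$ if it satisfies (Sim$_k$) for every $k\in K$ and (Sim$\star$) for every $\star\in\Lambda$ (worlds range over $W$): (Sim$_k$) if $(w,v)\in S$ and $w\in P_k$ then $v\in P_k$; (Sim$\smile$) if $(w,v)\in S$ and $wRs$ then there is $t$ with $vRt$ and $(t,s)\in S$; (Sim$\frown$) if $(w,v)\in S$ and $vRt$ then there is $s$ with $wRs$ and $(t,s)\in S$; (Sim$\circ_\smile$)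 if $(w,v)\in S$ and $vRt$ then either $(v,t)\in S$, or both $(v,w)\in S$ and there is $s$ with $wRs$ and $(s,t)\in S$; (Sim$\circ_\frown$) if $(w,v)\in S$ and $vRt$ then either $(t,v)\in S$, or there is $s$ with $wRs$ and $(t,s)\in S$; (Sim$\bullet_\smile$) if $(w,v)\in S$ and $wRs$ then either $(w,s)\in S$, or there is $t$ with $vRt$ and $(t,s)\in S$; (Sim$\bullet_\frown$) if $(w,v)\in S$ and $wRs$ then either $(s,w)\in S$, or both $(v,w)\in S$ and there is $t$ with $vRt$ and $(s,t)\in S$. -}

module Defs where

open import Data.Bool using (Bool; T)
open import Data.Empty using (⊥)
open import Data.Unit using (⊤)
open import Data.Product using (Σ; _×_; ∃)
open import Data.Sum using (_⊎_)
open import Data.List using (List)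
open import Data.List.Relation.Unary.All using (All)
open import Relation.Nullary using (¬_)

record Model (K : Set) : Set₁ where
  field
    W     : Set
    inhab : W
    R     : W → W → Set
    P     : K → W → Set

data Conn : Set where
  smile frown oSmile oFrown bSmile bFrown : Conn

SimType : Set
SimType = Conn → Bool

data Form (K : Set) (Λ : SimType) : Set where
  var  : K → Form K Λ
  top  : Form K Λ
  bot  : Form K Λ
  _∧_  : Form K Λ → Form K Λ → Form K Λ
  _∨_  : Form K Λ → Form K Λ → Form K Λ
  op   : (c : Conn) → T (Λ c) → Form K Λ → Form K Λ

module _ {K : Set} (M : Model K) where
  open Model M

  connSem : Conn → (W → Set) → W → Set
  connSem smile  A w = Σ W λ v → R w v × ¬ A v
  connSem frown  A w = ∀ v → R w v → ¬ A v
  connSem oSmile A w = ¬ A w ⊎ (∀ v → R w v → A v)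
  connSem oFrown A w = A w ⊎ (∀ v → R w v → ¬ A v)
  connSem bSmile A w = A w × (Σ W λ v → R w v × ¬ A v)
  connSem bFrown A w = ¬ A w × (Σ W λ v → R w v × A v)

  _⊩_ : {Λ : SimType} → W → Form K Λ → Set
  w ⊩ var k     = P k w
  w ⊩ top       = ⊤
  w ⊩ bot       = ⊥
  w ⊩ (φ ∧ ψ)   = (w ⊩ φ) × (w ⊩ ψ)
  w ⊩ (φ ∨ ψ)   = (w ⊩ φ) ⊎ (w ⊩ ψ)
  w ⊩ op c _ φ  = connSem c (λ u → u ⊩ φ) w

  _⇝[_]_ : W → SimType → W → Set
  w ⇝[ Λ ] v = (φ : Form K Λ) → w ⊩ φ → v ⊩ φ

  SimClause : Conn → (W → W → Set) → Set
  SimClause smile S  = ∀ w v s → S w v → R w s → Σ W λ t → R v t × S t s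
  SimClause frown S  = ∀ w v t → S w v → R v t → Σ W λ s → R w s × S t s
  SimClause oSmile S = ∀ w v t → S w v → R v t →
                         S v t ⊎ (S v w × (Σ W λ s → R w s × S s t))
  SimClause oFrown S = ∀ w v t → S w v → R v t →
                         S t v ⊎ (Σ W λ s → R w s × S t s)
  SimClause bSmile S = ∀ w v s → S w v → R w s →
                         S w s ⊎ (Σ W λ t → R v t × S t s)
  SimClause bFrown S = ∀ w v s → S w v → R w s →
                         S s w ⊎ (S v w × (Σ W λ t → R v t × S s t))

  IsSimulation : SimType → (W → W → Set) → Set
  IsSimulation Λ S =
    (∀ k w v → S w v → P k w → P k v) ×
    (∀ c → T (Λ c) → SimClause c S)

  -- w →_Λ v (underlined arrow): some Λ-simulation contains (w , v)
  _↠[_]_ : W → SimType → W → Set₁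
  w ↠[ Λ ] v = Σ (W → W → Set) λ S → IsSimulation Λ S × S w v

  data MForm : Set where
    mvar  : K → MForm
    mtop  : MForm
    mbot  : MForm
    _m∧_  : MForm → MForm → MForm
    _m∨_  : MForm → MForm → MForm
    m∼    : MForm → MForm
    m□    : MForm → MForm
    m◇    : MForm → MForm

  _⊩ₘ_ : W → MForm → Set
  w ⊩ₘ mvar k    = P k w
  w ⊩ₘ mtop      = ⊤
  w ⊩ₘ mbot      = ⊥
  w ⊩ₘ (φ m∧ ψ)  = (w ⊩ₘ φ) × (w ⊩ₘ ψ)
  w ⊩ₘ (φ m∨ ψ)  = (w ⊩ₘ φ) ⊎ (w ⊩ₘ ψ)
  w ⊩ₘ m∼ φ      = ¬ (w ⊩ₘ φ)
  w ⊩ₘ m□ φ      = ∀ v → R w v → v ⊩ₘ φ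
  w ⊩ₘ m◇ φ      = Σ W λ v → R w v × v ⊩ₘ φ

  -- modal saturation; a set Δ of formulas is a predicate, finite subsets are
  -- finite lists of members of Δ
  ModallySaturated : Set₁
  ModallySaturated =
    (w : W) (Δ : MForm → Set) →
    ((Γ : List MForm) → All Δ Γ → Σ W λ v → R w v × All (v ⊩ₘ_) Γ) →
    Σ W λ v → R w v × ((φ : MForm) → Δ φ → v ⊩ₘ φ)

-- Each simulation clause is exactly what is needed to transfer the
-- matching connective along S, so simulations preserve L_Λ-truth.
-- Conversely ⇝ is itself a Λ-simulation. For a clause with an escape
-- disjunct, either that disjunct holds or a distinguishing formula φ
-- exists, and transferring the connective applied to ψ ∧ φ or ψ ∨ φ
-- yields, for every single ψ, a suitable successor. Since these ψ are
-- closed under ∧ (resp. ∨) and L_Λ translates into the classical modal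
-- language, modal saturation turns this into one successor handling all ψ.
{-# OPTIONS --safe #-}
module Submission where

open import Defs
open import Level using (0ℓ)
open import Axiom.ExcludedMiddle using (ExcludedMiddle)
open import Axiom.DoubleNegationElimination using (em⇒dne)
open import Function.Base using (_∘_)
open import Function.Bundles using (_⇔_; mk⇔)
open import Data.Bool using (T)
open import Data.Empty using (⊥-elim)
open import Data.Unit using (tt)
open import Data.Product using (Σ; _×_; _,_; proj₁; proj₂)
open import Data.Sum using (_⊎_; inj₁; inj₂; [_,_])
open import Data.List using (List; []; _∷_)
open import Data.List.Relation.Unary.All using (All; []; _∷_)
open import Relation.Nullary using (¬_; yes; no)

module _ {K : Set} (M : Model K) where
  open Model M

  private
    _⊨ₘ_ : W → MForm M → Set
    t ⊨ₘ χ = _⊩ₘ_ M t χ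

  ⋀ : List (MForm M) → MForm M
  ⋀ []      = mtop
  ⋀ (χ ∷ Γ) = χ m∧ ⋀ Γ

  ⊩ₘ-⋀⁻ : ∀ {t} Γ → t ⊨ₘ ⋀ Γ → All (t ⊨ₘ_) Γ
  ⊩ₘ-⋀⁻ []      _          = []
  ⊩ₘ-⋀⁻ (χ ∷ Γ) (tχ , tΓ)  = tχ ∷ ⊩ₘ-⋀⁻ Γ tΓ

  saturated-∧-closed : ModallySaturated M → ∀ w (Δ : MForm M → Set) →
                       Δ mtop → (∀ χ ξ → Δ χ → Δ ξ → Δ (χ m∧ ξ)) →
                       (∀ χ → Δ χ → Σ W λ t → R w t × t ⊨ₘ χ) →
                       Σ W λ t → R w t × (∀ χ → Δ χ → t ⊨ₘ χ)
  saturated-∧-closed sat w Δ Δ-top Δ-∧ Δ-realised = sat w Δ finitely-realised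
    where
    Δ-⋀ : ∀ Γ → All Δ Γ → Δ (⋀ Γ)
    Δ-⋀ []      []          = Δ-top
    Δ-⋀ (χ ∷ Γ) (Δχ ∷ ΔΓ)   = Δ-∧ χ (⋀ Γ) Δχ (Δ-⋀ Γ ΔΓ)

    finitely-realised : ∀ Γ → All Δ Γ → Σ W λ t → R w t × All (t ⊨ₘ_) Γ
    finitely-realised Γ ΔΓ with Δ-realised (⋀ Γ) (Δ-⋀ Γ ΔΓ)
    ... | t , wRt , t⊨⋀Γ = t , wRt , ⊩ₘ-⋀⁻ Γ t⊨⋀Γ

  Preserves : (W → W → Set) → (W → Set) → Set
  Preserves S A = ∀ {x y} → S x y → A x → A y

  bSmile⇒¬oSmile : ∀ {A w} → connSem M bSmile A w → ¬ connSem M oSmile A w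
  bSmile⇒¬oSmile (Aw , _ , _ , _)     (inj₁ ¬Aw) = ¬Aw Aw
  bSmile⇒¬oSmile (_ , v , wRv , ¬Av)  (inj₂ ∀A)  = ¬Av (∀A v wRv)

  bFrown⇒¬oFrown : ∀ {A w} → connSem M bFrown A w → ¬ connSem M oFrown A w
  bFrown⇒¬oFrown (¬Aw , _ , _ , _)   (inj₁ Aw)  = ¬Aw Aw
  bFrown⇒¬oFrown (_ , v , wRv , Av)  (inj₂ ∀¬A) = ∀¬A v wRv Av

  module _ (lem : ExcludedMiddle 0ℓ) where

    ¬oSmile⇒bSmile : ∀ {A w} → ¬ connSem M oSmile A w → connSem M bSmile A w
    ¬oSmile⇒bSmile ¬○ =
      em⇒dne lem (¬○ ∘ inj₁) ,
      em⇒dne lem λ ¬∃ → ¬○ (inj₂ λ v wRv → em⇒dne lem λ ¬Av → ¬∃ (v , wRv , ¬Av))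

    ¬oFrown⇒bFrown : ∀ {A w} → ¬ connSem M oFrown A w → connSem M bFrown A w
    ¬oFrown⇒bFrown ¬○ =
      ¬○ ∘ inj₁ ,
      em⇒dne lem λ ¬∃ → ¬○ (inj₂ λ v wRv Av → ¬∃ (v , wRv , Av))

    connSem-preserved : ∀ c {S A} → SimClause M c S → Preserves S A →
                        Preserves S (connSem M c A)
    connSem-preserved smile sim pres {x} {y} Sxy (u , xRu , ¬Au)
      with sim x y u Sxy xRu
    ... | t , yRt , Stu = t , yRt , ¬Au ∘ pres Stu
    connSem-preserved frown sim pres {x} {y} Sxy ∀¬A t yRt At
      with sim x y t Sxy yRt
    ... | u , xRu , Stu = ∀¬A u xRu (pres Stu At)
    connSem-preserved oSmile {S} {A} sim pres {x} {y} Sxy x⊨○ with lem {A y}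
    ... | no ¬Ay = inj₁ ¬Ay
    ... | yes Ay = inj₂ λ t yRt → successor (sim x y t Sxy yRt) x⊨○
      where
      successor : ∀ {t} → S y t ⊎ (S y x × Σ W λ u → R x u × S u t) →
                  connSem M oSmile A x → A t
      successor (inj₁ Syt)                 _          = pres Syt Ay
      successor (inj₂ (Syx , _ , _ , _))   (inj₁ ¬Ax) = ⊥-elim (¬Ax (pres Syx Ay))
      successor (inj₂ (_ , u , xRu , Sut)) (inj₂ ∀A)  = pres Sut (∀A u xRu)
    connSem-preserved oFrown sim pres Sxy (inj₁ Ax) = inj₁ (pres Sxy Ax)
    connSem-preserved oFrown {S} {A} sim pres {x} {y} Sxy (inj₂ ∀¬A) with lem {A y}
    ... | yes Ay = inj₁ Ay
    ... | no ¬Ay = inj₂ λ t yRt At → [ (λ Sty → ¬Ay (pres Sty At))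
                                      , (λ (u , xRu , Stu) → ∀¬A u xRu (pres Stu At)) ]
                                      (sim x y t Sxy yRt)
    connSem-preserved bSmile sim pres {x} {y} Sxy (Ax , u , xRu , ¬Au)
      with sim x y u Sxy xRu
    ... | inj₁ Sxu              = ⊥-elim (¬Au (pres Sxu Ax))
    ... | inj₂ (t , yRt , Stu)  = pres Sxy Ax , t , yRt , ¬Au ∘ pres Stu
    connSem-preserved bFrown sim pres {x} {y} Sxy (¬Ax , u , xRu , Au)
      with sim x y u Sxy xRu
    ... | inj₁ Sux                      = ⊥-elim (¬Ax (pres Sux Au))
    ... | inj₂ (Syx , t , yRt , Sut)    = ¬Ax ∘ pres Syx , t , yRt , pres Sut Au

module _ {K : Set} (Λ : SimType) (M : Model K) where
  open Model M

  private
    _⊨_ : W → Form K Λ → Set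
    t ⊨ φ = _⊩_ M t φ

    _⊨ₘ_ : W → MForm M → Set
    t ⊨ₘ χ = _⊩ₘ_ M t χ

    _⇝_ : W → W → Set
    x ⇝ y = _⇝[_]_ M x Λ y

  translate : Form K Λ → MForm M
  translate (var k)          = mvar k
  translate top              = mtop
  translate bot              = mbot
  translate (φ ∧ ψ)          = translate φ m∧ translate ψ
  translate (φ ∨ ψ)          = translate φ m∨ translate ψ
  translate (op smile _ φ)   = m◇ (m∼ (translate φ))
  translate (op frown _ φ)   = m□ (m∼ (translate φ))
  translate (op oSmile _ φ)  = m∼ (translate φ) m∨ m□ (translate φ)
  translate (op oFrown _ φ)  = translate φ m∨ m□ (m∼ (translate φ))
  translate (op bSmile _ φ)  = translate φ m∧ m◇ (m∼ (translate φ))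
  translate (op bFrown _ φ)  = m∼ (translate φ) m∧ m◇ (translate φ)

  translate-⊩⁺ : ∀ φ {t} → t ⊨ φ → t ⊨ₘ translate φ
  translate-⊩⁻ : ∀ φ {t} → t ⊨ₘ translate φ → t ⊨ φ
  translate-⊩⁺ (var k)         h               = h
  translate-⊩⁺ top             h               = h
  translate-⊩⁺ bot             ()
  translate-⊩⁺ (φ ∧ ψ)         (a , b)         = translate-⊩⁺ φ a , translate-⊩⁺ ψ b
  translate-⊩⁺ (φ ∨ ψ)         (inj₁ a)        = inj₁ (translate-⊩⁺ φ a)
  translate-⊩⁺ (φ ∨ ψ)         (inj₂ b)        = inj₂ (translate-⊩⁺ ψ b)
  translate-⊩⁺ (op smile _ φ)  (u , r , n)     = u , r , n ∘ translate-⊩⁻ φ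
  translate-⊩⁺ (op frown _ φ)  f               = λ u r → f u r ∘ translate-⊩⁻ φ
  translate-⊩⁺ (op oSmile _ φ) (inj₁ n)        = inj₁ (n ∘ translate-⊩⁻ φ)
  translate-⊩⁺ (op oSmile _ φ) (inj₂ f)        = inj₂ λ u r → translate-⊩⁺ φ (f u r)
  translate-⊩⁺ (op oFrown _ φ) (inj₁ a)        = inj₁ (translate-⊩⁺ φ a)
  translate-⊩⁺ (op oFrown _ φ) (inj₂ f)        = inj₂ λ u r → f u r ∘ translate-⊩⁻ φ
  translate-⊩⁺ (op bSmile _ φ) (a , u , r , n) = translate-⊩⁺ φ a , u , r , n ∘ translate-⊩⁻ φ
  translate-⊩⁺ (op bFrown _ φ) (n , u , r , a) = n ∘ translate-⊩⁻ φ , u , r , translate-⊩⁺ φ a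
  translate-⊩⁻ (var k)         h               = h
  translate-⊩⁻ top             h               = h
  translate-⊩⁻ bot             ()
  translate-⊩⁻ (φ ∧ ψ)         (a , b)         = translate-⊩⁻ φ a , translate-⊩⁻ ψ b
  translate-⊩⁻ (φ ∨ ψ)         (inj₁ a)        = inj₁ (translate-⊩⁻ φ a)
  translate-⊩⁻ (φ ∨ ψ)         (inj₂ b)        = inj₂ (translate-⊩⁻ ψ b)
  translate-⊩⁻ (op smile _ φ)  (u , r , n)     = u , r , n ∘ translate-⊩⁺ φ
  translate-⊩⁻ (op frown _ φ)  f               = λ u r → f u r ∘ translate-⊩⁺ φ
  translate-⊩⁻ (op oSmile _ φ) (inj₁ n)        = inj₁ (n ∘ translate-⊩⁺ φ)
  translate-⊩⁻ (op oSmile _ φ) (inj₂ f)        = inj₂ λ u r → translate-⊩⁻ φ (f u r)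
  translate-⊩⁻ (op oFrown _ φ) (inj₁ a)        = inj₁ (translate-⊩⁻ φ a)
  translate-⊩⁻ (op oFrown _ φ) (inj₂ f)        = inj₂ λ u r → f u r ∘ translate-⊩⁺ φ
  translate-⊩⁻ (op bSmile _ φ) (a , u , r , n) = translate-⊩⁻ φ a , u , r , n ∘ translate-⊩⁺ φ
  translate-⊩⁻ (op bFrown _ φ) (n , u , r , a) = n ∘ translate-⊩⁺ φ , u , r , translate-⊩⁻ φ a

  module _ (lem : ExcludedMiddle 0ℓ) where

    simulation⇒⇝ : ∀ {S} → IsSimulation M Λ S → ∀ {w v} → S w v → w ⇝ v
    simulation⇒⇝ {S} (sim-var , sim-op) Swv φ = ⊩-preserved φ Swv
      where
      ⊩-preserved : ∀ φ → Preserves M S (_⊨ φ)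
      ⊩-preserved (var k)     Sxy  = sim-var k _ _ Sxy
      ⊩-preserved top         _    = _
      ⊩-preserved bot         _ ()
      ⊩-preserved (φ ∧ ψ)     Sxy  (a , b)  = ⊩-preserved φ Sxy a , ⊩-preserved ψ Sxy b
      ⊩-preserved (φ ∨ ψ)     Sxy  (inj₁ a) = inj₁ (⊩-preserved φ Sxy a)
      ⊩-preserved (φ ∨ ψ)     Sxy  (inj₂ b) = inj₂ (⊩-preserved ψ Sxy b)
      ⊩-preserved (op c c∈Λ φ)     = connSem-preserved M lem c (sim-op c c∈Λ) (⊩-preserved φ)

    ¬⇝⇒distinguishing : ∀ {x y} → ¬ x ⇝ y → Σ (Form K Λ) λ φ → x ⊨ φ × ¬ y ⊨ φ
    ¬⇝⇒distinguishing {x} {y} x⇝̸y with lem {Σ (Form K Λ) λ φ → x ⊨ φ × ¬ y ⊨ φ}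
    ... | yes distinguishing = distinguishing
    ... | no  indistinguishable =
      ⊥-elim (x⇝̸y λ φ x⊨φ → em⇒dne lem λ y⊭φ → indistinguishable (φ , x⊨φ , y⊭φ))

    module _ (sat : ModallySaturated M) where

      ⇝-to-successor : ∀ v s → (∀ ψ → s ⊨ ψ → Σ W λ t → R v t × t ⊨ ψ) →
                       Σ W λ t → R v t × s ⇝ t
      ⇝-to-successor v s realised
        with saturated-∧-closed M sat v Δ (top , tt , λ _ → tt) Δ-∧ Δ-realised
        where
        Δ : MForm M → Set
        Δ χ = Σ (Form K Λ) λ ψ → s ⊨ ψ × (∀ {t} → t ⊨ ψ → t ⊨ₘ χ)

        Δ-∧ : ∀ χ ξ → Δ χ → Δ ξ → Δ (χ m∧ ξ)
        Δ-∧ _ _ (ψ , s⊨ψ , ψ⇒χ) (ψ′ , s⊨ψ′ , ψ′⇒ξ) =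
          ψ ∧ ψ′ , (s⊨ψ , s⊨ψ′) , λ (a , b) → ψ⇒χ a , ψ′⇒ξ b

        Δ-realised : ∀ χ → Δ χ → Σ W λ t → R v t × t ⊨ₘ χ
        Δ-realised χ (ψ , s⊨ψ , ψ⇒χ) with realised ψ s⊨ψ
        ... | t , vRt , t⊨ψ = t , vRt , ψ⇒χ t⊨ψ
      ... | t , vRt , t⊨Δ =
        t , vRt , λ φ s⊨φ → translate-⊩⁻ φ (t⊨Δ (translate φ) (φ , s⊨φ , translate-⊩⁺ φ))

      ⇝-from-successor : ∀ v s → (∀ ψ → ¬ s ⊨ ψ → Σ W λ t → R v t × ¬ t ⊨ ψ) →
                         Σ W λ t → R v t × t ⇝ s
      ⇝-from-successor v s refuted
        with saturated-∧-closed M sat v Δ (bot , (λ ()) , λ _ → tt) Δ-∧ Δ-realised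
        where
        Δ : MForm M → Set
        Δ χ = Σ (Form K Λ) λ ψ → ¬ s ⊨ ψ × (∀ {t} → ¬ t ⊨ ψ → t ⊨ₘ χ)

        Δ-∧ : ∀ χ ξ → Δ χ → Δ ξ → Δ (χ m∧ ξ)
        Δ-∧ _ _ (ψ , s⊭ψ , ψ⇒χ) (ψ′ , s⊭ψ′ , ψ′⇒ξ) =
          ψ ∨ ψ′ , [ s⊭ψ , s⊭ψ′ ] , λ t⊭ → ψ⇒χ (t⊭ ∘ inj₁) , ψ′⇒ξ (t⊭ ∘ inj₂)

        Δ-realised : ∀ χ → Δ χ → Σ W λ t → R v t × t ⊨ₘ χ
        Δ-realised χ (ψ , s⊭ψ , ψ⇒χ) with refuted ψ s⊭ψ
        ... | t , vRt , t⊭ψ = t , vRt , ψ⇒χ t⊭ψ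
      ... | t , vRt , t⊨Δ =
        t , vRt , λ φ t⊨φ → em⇒dne lem λ s⊭φ →
          t⊨Δ (m∼ (translate φ)) (φ , s⊭φ , _∘ translate-⊩⁻ φ) (translate-⊩⁺ φ t⊨φ)

      ⇝-smile : T (Λ smile) → SimClause M smile _⇝_
      ⇝-smile p w v s w⇝v wRs =
        ⇝-from-successor v s λ ψ s⊭ψ → w⇝v (op smile p ψ) (s , wRs , s⊭ψ)

      ⇝-frown : T (Λ frown) → SimClause M frown _⇝_
      ⇝-frown p w v t w⇝v vRt =
        ⇝-to-successor w t λ ψ t⊨ψ → em⇒dne lem λ ¬∃ →
          w⇝v (op frown p ψ) (λ u wRu u⊨ψ → ¬∃ (u , wRu , u⊨ψ)) t vRt t⊨ψ

      ⇝-oSmile : T (Λ oSmile) → SimClause M oSmile _⇝_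
      ⇝-oSmile p w v t w⇝v vRt with lem {v ⇝ t}
      ... | yes v⇝t = inj₁ v⇝t
      ... | no  v⇝̸t with ¬⇝⇒distinguishing v⇝̸t
      ... | φ , v⊨φ , t⊭φ = inj₂ (v⇝w , ⇝-from-successor w t refuted)
        where
        w⊨● : ∀ χ → v ⊨ χ → ¬ t ⊨ χ → connSem M bSmile (_⊨ χ) w
        w⊨● χ v⊨χ t⊭χ =
          ¬oSmile⇒bSmile M lem
            (bSmile⇒¬oSmile M (v⊨χ , t , vRt , t⊭χ) ∘ w⇝v (op oSmile p χ))

        v⇝w : v ⇝ w
        v⇝w ψ v⊨ψ = proj₁ (proj₁ (w⊨● (ψ ∧ φ) (v⊨ψ , v⊨φ) (t⊭φ ∘ proj₂)))

        refuted : ∀ ψ → ¬ t ⊨ ψ → Σ W λ u → R w u × ¬ u ⊨ ψ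
        refuted ψ t⊭ψ with proj₂ (w⊨● (ψ ∨ φ) (inj₂ v⊨φ) [ t⊭ψ , t⊭φ ])
        ... | u , wRu , u⊭ψ∨φ = u , wRu , u⊭ψ∨φ ∘ inj₁

      ⇝-oFrown : T (Λ oFrown) → SimClause M oFrown _⇝_
      ⇝-oFrown p w v t w⇝v vRt with lem {t ⇝ v}
      ... | yes t⇝v = inj₁ t⇝v
      ... | no  t⇝̸v with ¬⇝⇒distinguishing t⇝̸v
      ... | φ , t⊨φ , v⊭φ = inj₂ (⇝-to-successor w t realised)
        where
        realised : ∀ ψ → t ⊨ ψ → Σ W λ u → R w u × u ⊨ ψ
        realised ψ t⊨ψ
          with proj₂ (¬oFrown⇒bFrown M lem
                        (bFrown⇒¬oFrown M (v⊭φ ∘ proj₂ , t , vRt , (t⊨ψ , t⊨φ))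
                          ∘ w⇝v (op oFrown p (ψ ∧ φ))))
        ... | u , wRu , u⊨ψ∧φ = u , wRu , proj₁ u⊨ψ∧φ

      ⇝-bSmile : T (Λ bSmile) → SimClause M bSmile _⇝_
      ⇝-bSmile p w v s w⇝v wRs with lem {w ⇝ s}
      ... | yes w⇝s = inj₁ w⇝s
      ... | no  w⇝̸s with ¬⇝⇒distinguishing w⇝̸s
      ... | φ , w⊨φ , s⊭φ = inj₂ (⇝-from-successor v s refuted)
        where
        refuted : ∀ ψ → ¬ s ⊨ ψ → Σ W λ u → R v u × ¬ u ⊨ ψ
        refuted ψ s⊭ψ
          with w⇝v (op bSmile p (ψ ∨ φ)) (inj₂ w⊨φ , s , wRs , [ s⊭ψ , s⊭φ ])
        ... | _ , u , vRu , u⊭ψ∨φ = u , vRu , u⊭ψ∨φ ∘ inj₁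

      ⇝-bFrown : T (Λ bFrown) → SimClause M bFrown _⇝_
      ⇝-bFrown p w v s w⇝v wRs with lem {s ⇝ w}
      ... | yes s⇝w = inj₁ s⇝w
      ... | no  s⇝̸w with ¬⇝⇒distinguishing s⇝̸w
      ... | φ , s⊨φ , w⊭φ = inj₂ (v⇝w , ⇝-to-successor v s realised)
        where
        v⊨● : ∀ χ → s ⊨ χ → ¬ w ⊨ χ → v ⊨ op bFrown p χ
        v⊨● χ s⊨χ w⊭χ = w⇝v (op bFrown p χ) (w⊭χ , s , wRs , s⊨χ)

        v⇝w : v ⇝ w
        v⇝w ψ v⊨ψ = em⇒dne lem λ w⊭ψ →
          proj₁ (v⊨● (ψ ∨ φ) (inj₂ s⊨φ) [ w⊭ψ , w⊭φ ]) (inj₁ v⊨ψ)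

        realised : ∀ ψ → s ⊨ ψ → Σ W λ u → R v u × u ⊨ ψ
        realised ψ s⊨ψ with proj₂ (v⊨● (ψ ∧ φ) (s⊨ψ , s⊨φ) (w⊭φ ∘ proj₂))
        ... | u , vRu , u⊨ψ∧φ = u , vRu , proj₁ u⊨ψ∧φ

      ⇝-isSimulation : IsSimulation M Λ _⇝_
      ⇝-isSimulation = (λ k _ _ x⇝y → x⇝y (var k)) , ⇝-clause
        where
        ⇝-clause : ∀ c → T (Λ c) → SimClause M c _⇝_
        ⇝-clause smile  = ⇝-smile
        ⇝-clause frown  = ⇝-frown
        ⇝-clause oSmile = ⇝-oSmile
        ⇝-clause oFrown = ⇝-oFrown
        ⇝-clause bSmile = ⇝-bSmile
        ⇝-clause bFrown = ⇝-bFrown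

theorem6p8 : ExcludedMiddle 0ℓ → {K : Set} (Λ : SimType) (M : Model K) →
    ModallySaturated M →
    (w v : Model.W M) → (_⇝[_]_ M w Λ v) ⇔ (_↠[_]_ M w Λ v)
theorem6p8 lem Λ M sat w v =
  mk⇔ (λ w⇝v → _ , ⇝-isSimulation Λ M lem sat , w⇝v)
      (λ (S , isSim , Swv) → simulation⇒⇝ Λ M lem isSim Swv)
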